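{- For $\alpha\in S_3$ let $d_n(\emptyset;\alpha)$ be the number of permutations of $\{1,\dots,n\}$ with no fixed points that contain exactly one occurrence of $\alpha$. Call $\alpha,\beta\in S_3$ almost-$D$-Wilf equivalent if $d_n(\emptyset;\alpha)=d_n(\emptyset;\beta)$ for all $n\ge3$. Then there are exactly four almost-$D$-Wilf equivalence classes among the patterns $\alpha\in S_3$.
   Context: An occurrence of $\alpha\in S_3$ in a permutation $\pi=\pi_1\cdots\pi_n$ is a triple of indices $i<j<k$ such that $\pi_i\pi_j\pi_k$ is order-isomorphic to $\alpha$. A fixed point is an index $i$ with $\pi_i=i$. -}

module Defs where

open import Data.Nat using (ℕ; zero; suc; _≤_)
open import Data.Fin using (Fin; toℕ; _<?_)
import Data.Fin as Fin
open import Data.Product using (Σ; _×_; _,_)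
open import Data.Nat.Properties using () renaming (_≟_ to _≟ⁿ_)
open import Data.Fin.Permutation using (Permutation′; _⟨$⟩ʳ_)
open import Data.List using (List; []; _∷_; concatMap; map; filter; length; allFin)
open import Data.Vec using (Vec; lookup)
import Data.Vec as V
open import Data.Bool using (Bool; true; false; _∧_; _∨_; not; if_then_else_)
open import Data.Bool.Properties using () renaming (_≟_ to _≟ᵇ_)
open import Data.Fin.Properties using () renaming (_≟_ to _≟ᶠ_)
open import Relation.Nullary.Decidable using (⌊_⌋)
open import Relation.Binary.PropositionalEquality using (_≡_)
open import Function using (_⇔_)

S₃ : Set
S₃ = Permutation′ 3

allᵇ : ∀ {n} → (Fin n → Bool) → Bool
allᵇ {n} p = Data.List.foldr (λ i b → p i ∧ b) true (allFin n)

anyᵇ : ∀ {n} → (Fin n → Bool) → Bool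
anyᵇ {n} p = Data.List.foldr (λ i b → p i ∨ b) false (allFin n)

words : (n k : ℕ) → List (Vec (Fin n) k)
words n zero    = V.[] ∷ []
words n (suc k) = concatMap (λ w → map (λ a → a V.∷ w) (allFin n)) (words n k)

-- A word of length n over Fin n is a permutation iff it is injective.
isPermᵇ : ∀ {n} → Vec (Fin n) n → Bool
isPermᵇ v = allᵇ (λ i → allᵇ (λ j → ⌊ i ≟ᶠ j ⌋ ∨ not ⌊ lookup v i ≟ᶠ lookup v j ⌋))

-- All permutations of {1,…,n} (0-indexed as Fin n), in one-line notation.
perms : (n : ℕ) → List (Vec (Fin n) n)
perms n = filter (λ v → isPermᵇ v ≟ᵇ true) (words n n)

derangementᵇ : ∀ {n} → Vec (Fin n) n → Bool
derangementᵇ v = not (anyᵇ (λ i → ⌊ lookup v i ≟ᶠ i ⌋))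

orderIsoᵇ : ∀ {n} → (Fin 3 → Fin n) → S₃ → Bool
orderIsoᵇ x α = allᵇ (λ a → allᵇ (λ b →
  ⌊ ⌊ x a <? x b ⌋ ≟ᵇ ⌊ (α ⟨$⟩ʳ a) <? (α ⟨$⟩ʳ b) ⌋ ⌋))

occurrences : ∀ {n} → Vec (Fin n) n → S₃ → ℕ
occurrences {n} v α =
  length (filter (λ t → isOcc t ≟ᵇ true)
    (concatMap (λ i → concatMap (λ j → map (λ k → (i , j , k)) (allFin n)) (allFin n)) (allFin n)))
  where
  isOcc : Fin n × Fin n × Fin n → Bool
  isOcc (i , j , k) = ⌊ i <? j ⌋ ∧ ⌊ j <? k ⌋ ∧ orderIsoᵇ (λ a → lookup v (tri a)) α
    where
    tri : Fin 3 → Fin n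
    tri Fin.zero = i
    tri (Fin.suc Fin.zero) = j
    tri (Fin.suc (Fin.suc Fin.zero)) = k

d : ℕ → S₃ → ℕ
d n α = length (filter (λ v → (derangementᵇ v ∧ ⌊ occurrences v α ≟ⁿ 1 ⌋) ≟ᵇ true) (perms n))

AlmostDWilf : S₃ → S₃ → Set
AlmostDWilf α β = ∀ n → 3 ≤ n → d n α ≡ d n β

-- An equivalence relation R on A has exactly k classes: there is a surjective
-- class map c : A → Fin k with c a ≡ c b exactly when R a b.
HasExactlyClasses : {A : Set} → (A → A → Set) → ℕ → Set
HasExactlyClasses {A} R k =
  Σ (A → Fin k) λ c → (∀ q → Σ A λ a → c a ≡ q) × (∀ a b → (c a ≡ c b) ⇔ R a b)

module Submission where

open import Defs
open import Algebra.Bundles using (CommutativeMonoid)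
open import Algebra.Definitions using (Involutive)
open import Data.Bool using (Bool; true; false; _∧_; _∨_; not)
open import Data.Bool.Properties using (⇔→≡; ∧-commutativeMonoid) renaming (_≟_ to _≟ᵇ_)
open import Data.Empty using (⊥-elim)
open import Algebra.Properties.CommutativeSemigroup (CommutativeMonoid.commutativeSemigroup ∧-commutativeMonoid)
  using () renaming (x∙yz≈y∙xz to ∧-left-comm)
open import Data.Fin using (Fin; _<_; _<?_; opposite)
open import Data.Fin.Patterns using (0F; 1F; 2F; 3F)
open import Data.Fin.Permutation using (Permutation′; _⟨$⟩ʳ_; _∘ₚ_; reverse; transpose; id)
open import Data.Fin.Properties using (opposite-involutive; opposite-prop; toℕ<n) renaming (_≟_ to _≟ᶠ_)
open import Data.List using (List; []; _∷_; _++_; filter; length; concatMap; map; allFin; foldr; cartesianProductWith; cartesianProduct)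
open import Data.List.Membership.Propositional using (_∈_)
open import Data.List.Membership.Propositional.Properties using (∈-map⁺; ∈-allFin; ∈-cartesianProductWith⁺)
open import Data.List.Membership.Propositional.Properties.WithK using (unique∧set⇒bag)
open import Data.List.Properties using (concatMap-cong; map-concatMap; map-∘)
open import Data.List.Relation.Binary.BagAndSetEquality using (∼bag⇒↭; _∼[_]_; set)
open import Data.List.Relation.Binary.Permutation.Propositional using (_↭_)
open import Data.List.Relation.Binary.Permutation.Propositional.Properties using (↭-length; filter-↭)
open import Data.List.Relation.Unary.Any using (here; there)
open import Data.List.Relation.Unary.All using () renaming ([] to []ᴬ)
open import Data.List.Relation.Unary.Unique.Propositional using (Unique) renaming ([] to []ᵁ; _∷_ to _∷ᵁ_)
open import Data.List.Relation.Unary.Unique.Propositional.Properties using (map⁺; allFin⁺; cartesianProductWith⁺)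
open import Data.Nat using (ℕ; zero; suc; _≤_; s≤s) renaming (_<_ to _<ℕ_)
open import Data.Nat.Properties using (∸-monoʳ-<; m≤m+n) renaming (_≟_ to _≟ⁿ_)
open import Data.Product using (_×_; _,_; proj₁; proj₂; ∃₂; swap)
open import Data.Vec using (Vec; lookup; tabulate)
import Data.Vec as Vec
open import Data.Vec.Properties using (lookup∘tabulate; tabulate∘lookup; tabulate-cong; ∷-injective)
open import Function using (_∘_; _⇔_; mk⇔; Equivalence)
open import Function.Properties.Inverse using (↔⇒↣)
open import Function.Bundles using (Injection)
open import Relation.Nullary using (Dec)
open import Relation.Nullary.Decidable using (⌊_⌋; isYes≗does; does-⇔)
open import Relation.Binary.PropositionalEquality
  using (_≡_; _≢_; refl; sym; trans; cong; cong₂; subst; subst₂; module ≡-Reasoning)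

-- Reverse-complement, πᵢ ↦ n+1−π_{n+1−i}, sends a fixed point i to the fixed point
-- n+1−i, so (unlike reverse or complement alone) it maps derangements to derangements,
-- and it maps occurrences of α bijectively to occurrences of α's reverse-complement.
-- Hence d_n(∅;α) = d_n(∅;α^rc), which merges 132 with 213 and 231 with 312, while 123
-- and 321 are fixed. The profiles (d₃, d₄, d₅) of the classes of 123, 321, 132 and 231
-- are (0,2,14), (0,0,0), (0,2,8) and (1,2,6), so no two of these classes merge.

-- Counting along enumerations

count : {A : Set} → (A → Bool) → List A → ℕ
count p xs = length (filter (λ x → p x ≟ᵇ true) xs)

count-cong : {A : Set} {p q : A → Bool} → (∀ x → p x ≡ q x) → ∀ xs → count p xs ≡ count q xs
count-cong p≗q [] = refl
count-cong {q = q} p≗q (x ∷ xs) rewrite p≗q x with q x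
... | true  = cong suc (count-cong p≗q xs)
... | false = count-cong p≗q xs

count-filter : {A : Set} (p q : A → Bool) → ∀ xs →
  count p (filter (λ x → q x ≟ᵇ true) xs) ≡ count (λ x → q x ∧ p x) xs
count-filter p q [] = refl
count-filter p q (x ∷ xs) with q x
... | false = count-filter p q xs
... | true with p x
...   | true  = cong suc (count-filter p q xs)
...   | false = count-filter p q xs

count-map : {A B : Set} (p : B → Bool) (f : A → B) → ∀ xs → count p (map f xs) ≡ count (p ∘ f) xs
count-map p f [] = refl
count-map p f (x ∷ xs) with p (f x)
... | true  = cong suc (count-map p f xs)
... | false = count-map p f xs

IsEnumeration : {A : Set} → List A → Set
IsEnumeration xs = Unique xs × (∀ x → x ∈ xs)

count-∘-involution : {A : Set} (p : A → Bool) {f : A → A} → Involutive _≡_ f →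
  ∀ {xs} → IsEnumeration xs → count (p ∘ f) xs ≡ count p xs
count-∘-involution p {f} f-inv {xs} (unique , complete) =
  trans (sym (count-map p f xs)) (↭-length (filter-↭ (λ x → p x ≟ᵇ true) map-f-xs↭xs))
  where
  f-injective : ∀ {x y} → f x ≡ f y → x ≡ y
  f-injective {x} {y} fx≡fy = trans (sym (f-inv x)) (trans (cong f fx≡fy) (f-inv y))
  same-set : map f xs ∼[ set ] xs
  same-set {x} = mk⇔ (λ _ → complete x) (λ _ → subst (_∈ map f xs) (f-inv x) (∈-map⁺ f (complete (f x))))
  map-f-xs↭xs : map f xs ↭ xs
  map-f-xs↭xs = ∼bag⇒↭ (unique∧set⇒bag (map⁺ f-injective unique) unique same-set)

concatMap-map≡cartesianProductWith : {A B C : Set} (f : A → B → C) → ∀ xs ys →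
  concatMap (λ x → map (f x) ys) xs ≡ cartesianProductWith f xs ys
concatMap-map≡cartesianProductWith f [] ys = refl
concatMap-map≡cartesianProductWith f (x ∷ xs) ys = cong (map (f x) ys ++_) (concatMap-map≡cartesianProductWith f xs ys)

cartesianProductWith-isEnumeration : {A B C : Set} (f : A → B → C) →
  (∀ {a a′ b b′} → f a b ≡ f a′ b′ → a ≡ a′ × b ≡ b′) → (∀ c → ∃₂ λ a b → f a b ≡ c) →
  ∀ {xs ys} → IsEnumeration xs → IsEnumeration ys → IsEnumeration (cartesianProductWith f xs ys)
cartesianProductWith-isEnumeration f f-injective f-surjective {xs} {ys} (xs! , xs-complete) (ys! , ys-complete) =
  cartesianProductWith⁺ f f-injective xs! ys! , complete
  where
  complete : ∀ c → c ∈ cartesianProductWith f xs ys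
  complete c with f-surjective c
  ... | a , b , refl = ∈-cartesianProductWith⁺ f (xs-complete a) (ys-complete b)

allFin-isEnumeration : ∀ n → IsEnumeration (allFin n)
allFin-isEnumeration n = allFin⁺ n , ∈-allFin

words-isEnumeration : ∀ n k → IsEnumeration (words n k)
words-isEnumeration n zero = []ᴬ ∷ᵁ []ᵁ , λ { Vec.[] → here refl }
words-isEnumeration n (suc k) =
  subst IsEnumeration (sym (concatMap-map≡cartesianProductWith (λ w a → a Vec.∷ w) (words n k) (allFin n)))
    (cartesianProductWith-isEnumeration (λ w a → a Vec.∷ w) (swap ∘ ∷-injective)
      (λ { (a Vec.∷ w) → w , a , refl }) (words-isEnumeration n k) (allFin-isEnumeration n))

Triple : ℕ → Set
Triple n = Fin n × Fin n × Fin n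

triples : ∀ n → List (Triple n)
triples n = concatMap (λ i → concatMap (λ j → map (λ k → (i , j , k)) (allFin n)) (allFin n)) (allFin n)

triples≡cartesianProduct : ∀ n → triples n ≡ cartesianProduct (allFin n) (cartesianProduct (allFin n) (allFin n))
triples≡cartesianProduct n = begin
  triples n
    ≡⟨ concatMap-cong (λ i → sym (map-pairs i)) (allFin n) ⟩
  concatMap (λ i → map (i ,_) pairs) (allFin n)
    ≡⟨ concatMap-map≡cartesianProductWith _,_ (allFin n) pairs ⟩
  cartesianProduct (allFin n) pairs
    ≡⟨ cong (cartesianProduct (allFin n)) (concatMap-map≡cartesianProductWith _,_ (allFin n) (allFin n)) ⟩
  cartesianProduct (allFin n) (cartesianProduct (allFin n) (allFin n)) ∎
  where
  open ≡-Reasoning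
  pairs : List (Fin n × Fin n)
  pairs = concatMap (λ j → map (j ,_) (allFin n)) (allFin n)
  map-pairs : ∀ i → map (i ,_) pairs ≡ concatMap (λ j → map (λ k → (i , j , k)) (allFin n)) (allFin n)
  map-pairs i = trans (map-concatMap (i ,_) (λ j → map (j ,_) (allFin n)) (allFin n))
                      (concatMap-cong (λ j → sym (map-∘ (allFin n))) (allFin n))

triples-isEnumeration : ∀ n → IsEnumeration (triples n)
triples-isEnumeration n = subst IsEnumeration (sym (triples≡cartesianProduct n))
  (product (allFin-isEnumeration n) (product (allFin-isEnumeration n) (allFin-isEnumeration n)))
  where
  product : {A B : Set} {xs : List A} {ys : List B} → IsEnumeration xs → IsEnumeration ys →
    IsEnumeration (cartesianProduct xs ys)
  product = cartesianProductWith-isEnumeration _,_ (λ { refl → refl , refl }) (λ { (a , b) → a , b , refl })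

-- Boolean quantifiers over Fin n

allᵇ-true⁻ : ∀ {n} (p : Fin n → Bool) → allᵇ p ≡ true → ∀ i → p i ≡ true
allᵇ-true⁻ {n} p all-p i = go (allFin n) all-p (∈-allFin i)
  where
  go : ∀ xs → foldr (λ i b → p i ∧ b) true xs ≡ true → i ∈ xs → p i ≡ true
  go (x ∷ xs) all-p i∈ with p x in px
  go (x ∷ xs) all-p (here refl)  | true = px
  go (x ∷ xs) all-p (there i∈xs) | true = go xs all-p i∈xs

allᵇ-true⁺ : ∀ {n} (p : Fin n → Bool) → (∀ i → p i ≡ true) → allᵇ p ≡ true
allᵇ-true⁺ {n} p p-true = go (allFin n)
  where
  go : ∀ xs → foldr (λ i b → p i ∧ b) true xs ≡ true
  go [] = refl
  go (x ∷ xs) rewrite p-true x = go xs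

allᵇ-≡ : ∀ {n} {p q : Fin n → Bool} → (∀ i → p i ≡ true) ⇔ (∀ i → q i ≡ true) → allᵇ p ≡ allᵇ q
allᵇ-≡ {p = p} {q} p⇔q = ⇔→≡ {z = true} (mk⇔
  (allᵇ-true⁺ q ∘ Equivalence.to p⇔q ∘ allᵇ-true⁻ p)
  (allᵇ-true⁺ p ∘ Equivalence.from p⇔q ∘ allᵇ-true⁻ q))

allᵇ-cong : ∀ {n} {p q : Fin n → Bool} → (∀ i → p i ≡ q i) → allᵇ p ≡ allᵇ q
allᵇ-cong p≗q = allᵇ-≡ (mk⇔ (λ h i → trans (sym (p≗q i)) (h i)) (λ h i → trans (p≗q i) (h i)))

allᵇ-reindex : ∀ {n} {g : Fin n → Fin n} → Involutive _≡_ g → {p q : Fin n → Bool} →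
  (∀ i → q i ≡ p (g i)) → allᵇ q ≡ allᵇ p
allᵇ-reindex {g = g} g-inv {p} q≗p∘g = allᵇ-≡ (mk⇔
  (λ h i → subst (λ j → p j ≡ true) (g-inv i) (trans (sym (q≗p∘g (g i))) (h (g i))))
  (λ h i → trans (q≗p∘g i) (h (g i))))

allᵇ-comm : ∀ {n} (t : Fin n → Fin n → Bool) → allᵇ (λ a → allᵇ (λ b → t b a)) ≡ allᵇ (λ a → allᵇ (λ b → t a b))
allᵇ-comm t = allᵇ-≡ (mk⇔ (transposeAll t) (transposeAll (λ a b → t b a)))
  where
  transposeAll : ∀ s → (∀ a → allᵇ (λ b → s b a) ≡ true) → ∀ a → allᵇ (λ b → s a b) ≡ true
  transposeAll s h a = allᵇ-true⁺ (s a) (λ b → allᵇ-true⁻ (λ b′ → s b′ b) (h b) a)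

allᵇ²-reindex : ∀ {n} {g : Fin n → Fin n} → Involutive _≡_ g → {s t : Fin n → Fin n → Bool} →
  (∀ i j → t i j ≡ s (g i) (g j)) → allᵇ (λ i → allᵇ (t i)) ≡ allᵇ (λ i → allᵇ (s i))
allᵇ²-reindex g-inv t≗s∘g = allᵇ-reindex g-inv (λ i → allᵇ-reindex g-inv (t≗s∘g i))

anyᵇ≡not-allᵇ-not : ∀ {n} (p : Fin n → Bool) → anyᵇ p ≡ not (allᵇ (not ∘ p))
anyᵇ≡not-allᵇ-not {n} p = go (allFin n)
  where
  go : ∀ xs → foldr (λ i b → p i ∨ b) false xs ≡ not (foldr (λ i b → not (p i) ∧ b) true xs)
  go [] = refl
  go (x ∷ xs) with p x
  ... | true  = refl
  ... | false = go xs

anyᵇ-reindex : ∀ {n} {g : Fin n → Fin n} → Involutive _≡_ g → {p q : Fin n → Bool} →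
  (∀ i → q i ≡ p (g i)) → anyᵇ q ≡ anyᵇ p
anyᵇ-reindex g-inv {p} {q} q≗p∘g = begin
  anyᵇ q                 ≡⟨ anyᵇ≡not-allᵇ-not q ⟩
  not (allᵇ (not ∘ q))   ≡⟨ cong not (allᵇ-reindex g-inv (cong not ∘ q≗p∘g)) ⟩
  not (allᵇ (not ∘ p))   ≡⟨ sym (anyᵇ≡not-allᵇ-not p) ⟩
  anyᵇ p                 ∎
  where open ≡-Reasoning

⌊⌋-⇔ : {A B : Set} → A ⇔ B → (a? : Dec A) (b? : Dec B) → ⌊ a? ⌋ ≡ ⌊ b? ⌋
⌊⌋-⇔ A⇔B a? b? = trans (isYes≗does a?) (trans (does-⇔ A⇔B a? b?) (sym (isYes≗does b?)))

-- Reverse-complement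

opposite-injective : ∀ {n} {i j : Fin n} → opposite i ≡ opposite j → i ≡ j
opposite-injective {i = i} {j} eq = trans (sym (opposite-involutive i)) (trans (cong opposite eq) (opposite-involutive j))

opposite-reverses-< : ∀ {n} {i j : Fin n} → i < j → opposite j < opposite i
opposite-reverses-< {i = i} {j} i<j =
  subst₂ _<ℕ_ (sym (opposite-prop j)) (sym (opposite-prop i)) (∸-monoʳ-< (s≤s i<j) (toℕ<n j))

opposite-≟ : ∀ {n} (i j : Fin n) → ⌊ opposite i ≟ᶠ opposite j ⌋ ≡ ⌊ i ≟ᶠ j ⌋
opposite-≟ i j = ⌊⌋-⇔ (mk⇔ opposite-injective (cong opposite)) (opposite i ≟ᶠ opposite j) (i ≟ᶠ j)

opposite-≟-adjoint : ∀ {n} (i j : Fin n) → ⌊ opposite i ≟ᶠ j ⌋ ≡ ⌊ i ≟ᶠ opposite j ⌋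
opposite-≟-adjoint i j = trans (cong (λ k → ⌊ opposite i ≟ᶠ k ⌋) (sym (opposite-involutive j))) (opposite-≟ i (opposite j))

opposite-<? : ∀ {n} (i j : Fin n) → ⌊ opposite i <? opposite j ⌋ ≡ ⌊ j <? i ⌋
opposite-<? i j = ⌊⌋-⇔ (mk⇔ from opposite-reverses-<) (opposite i <? opposite j) (j <? i)
  where
  from : opposite i < opposite j → j < i
  from h = subst₂ _<_ (opposite-involutive j) (opposite-involutive i) (opposite-reverses-< h)

reverseComplement : ∀ {n} → Vec (Fin n) n → Vec (Fin n) n
reverseComplement v = tabulate (opposite ∘ lookup v ∘ opposite)

lookup-reverseComplement : ∀ {n} (v : Vec (Fin n) n) i →
  lookup (reverseComplement v) i ≡ opposite (lookup v (opposite i))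
lookup-reverseComplement v = lookup∘tabulate _

reverseComplement-involutive : ∀ {n} → Involutive _≡_ (reverseComplement {n})
reverseComplement-involutive v = trans (tabulate-cong rc-rc) (tabulate∘lookup v)
  where
  open ≡-Reasoning
  rc-rc : ∀ i → opposite (lookup (reverseComplement v) (opposite i)) ≡ lookup v i
  rc-rc i = begin
    opposite (lookup (reverseComplement v) (opposite i))  ≡⟨ cong opposite (lookup-reverseComplement v (opposite i)) ⟩
    opposite (opposite (lookup v (opposite (opposite i)))) ≡⟨ opposite-involutive _ ⟩
    lookup v (opposite (opposite i))                       ≡⟨ cong (lookup v) (opposite-involutive i) ⟩
    lookup v i                                             ∎

isPermᵇ-reverseComplement : ∀ {n} (v : Vec (Fin n) n) → isPermᵇ (reverseComplement v) ≡ isPermᵇ v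
isPermᵇ-reverseComplement v = allᵇ²-reindex opposite-involutive λ i j →
  cong₂ (λ s t → s ∨ not t) (sym (opposite-≟ i j))
    (trans (cong₂ (λ x y → ⌊ x ≟ᶠ y ⌋) (lookup-reverseComplement v i) (lookup-reverseComplement v j)) (opposite-≟ _ _))

derangementᵇ-reverseComplement : ∀ {n} (v : Vec (Fin n) n) → derangementᵇ (reverseComplement v) ≡ derangementᵇ v
derangementᵇ-reverseComplement v = cong not (anyᵇ-reindex opposite-involutive λ i →
  trans (cong (λ x → ⌊ x ≟ᶠ i ⌋) (lookup-reverseComplement v i)) (opposite-≟-adjoint _ i))

reverseComplementₚ : ∀ {n} → Permutation′ n → Permutation′ n
reverseComplementₚ α = reverse ∘ₚ α ∘ₚ reverse

orderIsoᵇ-cong : ∀ {n} {x y : Fin 3 → Fin n} {α β : S₃} → (∀ a → x a ≡ y a) → (∀ a → α ⟨$⟩ʳ a ≡ β ⟨$⟩ʳ a) →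
  orderIsoᵇ x α ≡ orderIsoᵇ y β
orderIsoᵇ-cong x≗y α≗β = allᵇ-cong λ a → allᵇ-cong λ b →
  cong₂ (λ s t → ⌊ s ≟ᵇ t ⌋) (cong₂ (λ s t → ⌊ s <? t ⌋) (x≗y a) (x≗y b)) (cong₂ (λ s t → ⌊ s <? t ⌋) (α≗β a) (α≗β b))

orderIsoᵇ-reverseComplement : ∀ {n} (x : Fin 3 → Fin n) (α : S₃) →
  orderIsoᵇ (opposite ∘ x ∘ opposite) (reverseComplementₚ α) ≡ orderIsoᵇ x α
orderIsoᵇ-reverseComplement x α = trans
  (allᵇ²-reindex opposite-involutive {s = λ a b → agree b a} λ a b →
    cong₂ (λ s t → ⌊ s ≟ᵇ t ⌋) (opposite-<? (x (opposite a)) (x (opposite b))) (opposite-<? (α ⟨$⟩ʳ opposite a) (α ⟨$⟩ʳ opposite b)))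
  (allᵇ-comm agree)
  where
  agree : Fin 3 → Fin 3 → Bool
  agree a b = ⌊ ⌊ x a <? x b ⌋ ≟ᵇ ⌊ α ⟨$⟩ʳ a <? α ⟨$⟩ʳ b ⌋ ⌋

triple : ∀ {n} → Triple n → Fin 3 → Fin n
triple (i , j , k) 0F = i
triple (i , j , k) 1F = j
triple (i , j , k) 2F = k

-- isOccurrence and triples restate the local definitions inside occurrences, so
-- occurrences v α is definitionally count (isOccurrence v α) (triples n).
isOccurrence : ∀ {n} → Vec (Fin n) n → S₃ → Triple n → Bool
isOccurrence v α t@(i , j , k) = ⌊ i <? j ⌋ ∧ ⌊ j <? k ⌋ ∧ orderIsoᵇ (lookup v ∘ triple t) α

reverseTriple : ∀ {n} → Triple n → Triple n
reverseTriple (i , j , k) = opposite k , opposite j , opposite i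

reverseTriple-involutive : ∀ {n} → Involutive _≡_ (reverseTriple {n})
reverseTriple-involutive (i , j , k) =
  cong₂ _,_ (opposite-involutive i) (cong₂ _,_ (opposite-involutive j) (opposite-involutive k))

triple-reverseTriple : ∀ {n} (t : Triple n) a → triple (reverseTriple t) (opposite a) ≡ opposite (triple t a)
triple-reverseTriple t 0F = refl
triple-reverseTriple t 1F = refl
triple-reverseTriple t 2F = refl

isOccurrence-reverseComplement : ∀ {n} (v : Vec (Fin n) n) α t →
  isOccurrence (reverseComplement v) (reverseComplementₚ α) t ≡ isOccurrence v α (reverseTriple t)
isOccurrence-reverseComplement v α t@(i , j , k) = begin
  ⌊ i <? j ⌋ ∧ ⌊ j <? k ⌋ ∧ orderIsoRC
    ≡⟨ cong₂ (λ b c → b ∧ c ∧ orderIsoRC) (sym (opposite-<? j i)) (sym (opposite-<? k j)) ⟩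
  ⌊ opposite j <? opposite i ⌋ ∧ ⌊ opposite k <? opposite j ⌋ ∧ orderIsoRC
    ≡⟨ ∧-left-comm ⌊ opposite j <? opposite i ⌋ ⌊ opposite k <? opposite j ⌋ orderIsoRC ⟩
  ⌊ opposite k <? opposite j ⌋ ∧ ⌊ opposite j <? opposite i ⌋ ∧ orderIsoRC
    ≡⟨ cong (λ c → ⌊ opposite k <? opposite j ⌋ ∧ ⌊ opposite j <? opposite i ⌋ ∧ c) orderIso-agrees ⟩
  isOccurrence v α (reverseTriple t) ∎
  where
  open ≡-Reasoning
  y : Fin 3 → Fin _
  y = lookup v ∘ triple (reverseTriple t)
  lookup-agrees : ∀ a → lookup (reverseComplement v) (triple t a) ≡ opposite (y (opposite a))
  lookup-agrees a = trans (lookup-reverseComplement v _) (cong (opposite ∘ lookup v) (sym (triple-reverseTriple t a)))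
  orderIsoRC : Bool
  orderIsoRC = orderIsoᵇ (lookup (reverseComplement v) ∘ triple t) (reverseComplementₚ α)
  orderIso-agrees : orderIsoRC ≡ orderIsoᵇ y α
  orderIso-agrees = trans (orderIsoᵇ-cong {α = reverseComplementₚ α} {β = reverseComplementₚ α} lookup-agrees (λ _ → refl)) (orderIsoᵇ-reverseComplement y α)

occurrences-reverseComplement : ∀ {n} (v : Vec (Fin n) n) α →
  occurrences (reverseComplement v) (reverseComplementₚ α) ≡ occurrences v α
occurrences-reverseComplement {n} v α =
  trans (count-cong {q = isOccurrence v α ∘ reverseTriple} (isOccurrence-reverseComplement v α) (triples n))
        (count-∘-involution (isOccurrence v α) {reverseTriple} reverseTriple-involutive (triples-isEnumeration n))

isCountedᵇ : ∀ {n} → S₃ → Vec (Fin n) n → Bool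
isCountedᵇ α v = isPermᵇ v ∧ derangementᵇ v ∧ ⌊ occurrences v α ≟ⁿ 1 ⌋

d≡count-words : ∀ n α → d n α ≡ count (isCountedᵇ α) (words n n)
d≡count-words n α = count-filter (λ v → derangementᵇ v ∧ ⌊ occurrences v α ≟ⁿ 1 ⌋) isPermᵇ (words n n)

isCountedᵇ-reverseComplement : ∀ {n} α (v : Vec (Fin n) n) →
  isCountedᵇ (reverseComplementₚ α) (reverseComplement v) ≡ isCountedᵇ α v
isCountedᵇ-reverseComplement α v = cong₂ _∧_ (isPermᵇ-reverseComplement v)
  (cong₂ (λ b m → b ∧ ⌊ m ≟ⁿ 1 ⌋) (derangementᵇ-reverseComplement v) (occurrences-reverseComplement v α))

d-reverseComplement : ∀ n α → d n (reverseComplementₚ α) ≡ d n α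
d-reverseComplement n α = begin
  d n (reverseComplementₚ α)                                       ≡⟨ d≡count-words n (reverseComplementₚ α) ⟩
  count (isCountedᵇ (reverseComplementₚ α)) (words n n)
    ≡⟨ count-∘-involution (isCountedᵇ (reverseComplementₚ α)) {reverseComplement} reverseComplement-involutive (words-isEnumeration n n) ⟨
  count (isCountedᵇ (reverseComplementₚ α) ∘ reverseComplement) (words n n)
    ≡⟨ count-cong {q = isCountedᵇ α} (isCountedᵇ-reverseComplement α) (words n n) ⟩
  count (isCountedᵇ α) (words n n)                                 ≡⟨ d≡count-words n α ⟨
  d n α                                                            ∎
  where open ≡-Reasoning

d-cong : ∀ n {α β : S₃} → (∀ a → α ⟨$⟩ʳ a ≡ β ⟨$⟩ʳ a) → d n α ≡ d n β
d-cong n {α} {β} α≗β = count-cong {q = λ v → derangementᵇ v ∧ ⌊ occurrences v β ≟ⁿ 1 ⌋}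
  (λ v → cong (λ m → derangementᵇ v ∧ ⌊ m ≟ⁿ 1 ⌋) (count-cong {q = isOccurrence v β} (isOccurrence-cong v) (triples n)))
  (perms n)
  where
  isOccurrence-cong : ∀ v t → isOccurrence v α t ≡ isOccurrence v β t
  isOccurrence-cong v t@(i , j , k) =
    cong (λ c → ⌊ i <? j ⌋ ∧ ⌊ j <? k ⌋ ∧ c) (orderIsoᵇ-cong {x = lookup v ∘ triple t} {α = α} {β} (λ _ → refl) α≗β)

-- The four classes

oneLine : S₃ → Fin 3 × Fin 3 × Fin 3
oneLine α = α ⟨$⟩ʳ 0F , α ⟨$⟩ʳ 1F , α ⟨$⟩ʳ 2F

oneLine-≡⇒≗ : ∀ {α β} → oneLine α ≡ oneLine β → ∀ a → α ⟨$⟩ʳ a ≡ β ⟨$⟩ʳ a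
oneLine-≡⇒≗ eq 0F = cong proj₁ eq
oneLine-≡⇒≗ eq 1F = cong (proj₁ ∘ proj₂) eq
oneLine-≡⇒≗ eq 2F = cong (proj₂ ∘ proj₂) eq

-- The last clause only catches one-line notations with a repeated letter.
wilfClassOfOneLine : Fin 3 × Fin 3 × Fin 3 → Fin 4
wilfClassOfOneLine (0F , 1F , 2F) = 0F
wilfClassOfOneLine (2F , 1F , 0F) = 1F
wilfClassOfOneLine (0F , 2F , 1F) = 2F
wilfClassOfOneLine (1F , 0F , 2F) = 2F
wilfClassOfOneLine (2F , 0F , 1F) = 3F
wilfClassOfOneLine (1F , 2F , 0F) = 3F
wilfClassOfOneLine _ = 0F

wilfClass : S₃ → Fin 4
wilfClass = wilfClassOfOneLine ∘ oneLine

representative : Fin 4 → S₃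
representative 0F = id
representative 1F = reverse
representative 2F = transpose 1F 2F
representative 3F = transpose 0F 1F ∘ₚ transpose 1F 2F

wilfClass-representative : ∀ c → wilfClass (representative c) ≡ c
wilfClass-representative 0F = refl
wilfClass-representative 1F = refl
wilfClass-representative 2F = refl
wilfClass-representative 3F = refl

d≡d-representative : ∀ n α → d n α ≡ d n (representative (wilfClass α))
d≡d-representative n α =
  byOneLine (α ⟨$⟩ʳ 0F) (α ⟨$⟩ʳ 1F) (α ⟨$⟩ʳ 2F) refl (distinct λ ()) (distinct λ ()) (distinct λ ())
  where
  distinct : ∀ {a b} → a ≢ b → α ⟨$⟩ʳ a ≢ α ⟨$⟩ʳ b
  distinct a≢b = a≢b ∘ Injection.injective (↔⇒↣ α)
  sameOneLine : ∀ β → oneLine α ≡ oneLine β → d n α ≡ d n β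
  sameOneLine β eq = d-cong n {α} {β} (oneLine-≡⇒≗ {α} {β} eq)
  reverseComplementOneLine : ∀ β → oneLine α ≡ oneLine (reverseComplementₚ β) → d n α ≡ d n β
  reverseComplementOneLine β eq = trans (sameOneLine (reverseComplementₚ β) eq) (d-reverseComplement n β)
  byOneLine : ∀ x y z → oneLine α ≡ (x , y , z) → x ≢ y → y ≢ z → x ≢ z →
    d n α ≡ d n (representative (wilfClassOfOneLine (x , y , z)))
  byOneLine 0F 1F 2F eq _ _ _ = sameOneLine (representative 0F) eq
  byOneLine 2F 1F 0F eq _ _ _ = sameOneLine (representative 1F) eq
  byOneLine 0F 2F 1F eq _ _ _ = sameOneLine (representative 2F) eq
  byOneLine 2F 0F 1F eq _ _ _ = sameOneLine (representative 3F) eq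
  byOneLine 1F 0F 2F eq _ _ _ = reverseComplementOneLine (representative 2F) eq
  byOneLine 1F 2F 0F eq _ _ _ = reverseComplementOneLine (representative 3F) eq
  byOneLine 0F 0F _  _ x≢y _ _ = ⊥-elim (x≢y refl)
  byOneLine 1F 1F _  _ x≢y _ _ = ⊥-elim (x≢y refl)
  byOneLine 2F 2F _  _ x≢y _ _ = ⊥-elim (x≢y refl)
  byOneLine _  0F 0F _ _ y≢z _ = ⊥-elim (y≢z refl)
  byOneLine _  1F 1F _ _ y≢z _ = ⊥-elim (y≢z refl)
  byOneLine _  2F 2F _ _ y≢z _ = ⊥-elim (y≢z refl)
  byOneLine 0F _  0F _ _ _ x≢z = ⊥-elim (x≢z refl)
  byOneLine 1F _  1F _ _ _ x≢z = ⊥-elim (x≢z refl)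
  byOneLine 2F _  2F _ _ _ x≢z = ⊥-elim (x≢z refl)

profile : Fin 4 → ℕ × ℕ × ℕ
profile c = d 3 (representative c) , d 4 (representative c) , d 5 (representative c)

classOfProfile : ℕ × ℕ × ℕ → Fin 4
classOfProfile (1 , _ , _) = 3F
classOfProfile (_ , 0 , _) = 1F
classOfProfile (_ , _ , 8) = 2F
classOfProfile _           = 0F

classOfProfile-profile : ∀ c → classOfProfile (profile c) ≡ c
classOfProfile-profile 0F = refl
classOfProfile-profile 1F = refl
classOfProfile-profile 2F = refl
classOfProfile-profile 3F = refl

profile-injective : ∀ {c c′} → profile c ≡ profile c′ → c ≡ c′
profile-injective {c} {c′} eq =
  trans (sym (classOfProfile-profile c)) (trans (cong classOfProfile eq) (classOfProfile-profile c′))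

-- Implicit arguments whose types mention d are passed explicitly throughout:
-- inferring them by unification makes Agda unfold d.
wilfClass-≡⇒AlmostDWilf : ∀ α β → wilfClass α ≡ wilfClass β → AlmostDWilf α β
wilfClass-≡⇒AlmostDWilf α β eq n _ = begin
  d n α                              ≡⟨ d≡d-representative n α ⟩
  d n (representative (wilfClass α)) ≡⟨ cong (d n ∘ representative) {wilfClass α} {wilfClass β} eq ⟩
  d n (representative (wilfClass β)) ≡⟨ d≡d-representative n β ⟨
  d n β                              ∎
  where open ≡-Reasoning

AlmostDWilf⇒wilfClass-≡ : ∀ α β → AlmostDWilf α β → wilfClass α ≡ wilfClass β
AlmostDWilf⇒wilfClass-≡ α β α≈β = profile-injective {wilfClass α} {wilfClass β}
  (cong₂ _,_ (agree 3 (m≤m+n 3 0)) (cong₂ _,_ (agree 4 (m≤m+n 3 1)) (agree 5 (m≤m+n 3 2))))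
  where
  open ≡-Reasoning
  agree : ∀ m → 3 ≤ m → d m (representative (wilfClass α)) ≡ d m (representative (wilfClass β))
  agree m 3≤m = begin
    d m (representative (wilfClass α)) ≡⟨ d≡d-representative m α ⟨
    d m α                              ≡⟨ α≈β m 3≤m ⟩
    d m β                              ≡⟨ d≡d-representative m β ⟩
    d m (representative (wilfClass β)) ∎

theorem6p4 : HasExactlyClasses AlmostDWilf 4
theorem6p4 =
  wilfClass ,
  (λ c → representative c , wilfClass-representative c) ,
  (λ α β → mk⇔ (wilfClass-≡⇒AlmostDWilf α β) (AlmostDWilf⇒wilfClass-≡ α β))
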